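{- For every word $w$ (with at least two distinct letters) there exists a one-dimensional grid $\Gamma$ such that $c_1(w,\Gamma)=C_1(w)$.
   Context: A one-dimensional grid of size $n$ is a map $\Gamma\colon\mathbb Z/n\mathbb Z\to\Sigma$ to an alphabet. For a word $w=w_0\cdots w_{\ell-1}$, an appearance of $w$ in $\Gamma$ is a pair $(p,v)\in\mathbb Z/n\mathbb Z\times\{ -1,1\}$ with $\Gamma(p+iv)=w_i$ for $0\le i<\ell$; $c_1(w,\Gamma)$ is the number of appearances divided by $n$, and $C_1(w)$ is the supremum of $c_1(w,\Gamma)$ over all one-dimensional grids (all sizes, all alphabets). -}

module Defs where

open import Data.Nat using (ℕ; zero; suc; _+_; _*_; _∸_; NonZero; _≡ᵇ_)
open import Data.Nat.DivMod using (_%_; m%n<n)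
open import Data.Fin using (Fin; fromℕ<)
open import Data.List using (List; []; _∷_; length)
open import Data.Bool using (Bool; true; false; _∧_; if_then_else_)
open import Data.Integer using (+_)
open import Data.Rational using (ℚ; _/_)

-- Letters are natural numbers (any finite word / finite grid over any
-- alphabet can be encoded injectively into ℕ).

-- A one-dimensional grid of size n : a map ℤ/nℤ → ℕ, ℤ/nℤ represented by Fin n.
Grid : ℕ → Set
Grid n = Fin n → ℕ

data Dir : Set where
  plus minus : Dir

-- The residue p + i·v (mod n), for p ∈ Fin-range, i ∈ ℕ.
step : (n : ℕ) → .{{_ : NonZero n}} → ℕ → Dir → ℕ → Fin n
step n p plus  i = fromℕ< (m%n<n (p + i) n)
step n p minus i = fromℕ< (m%n<n (p + (n ∸ (i % n))) n)

matchFrom : (n : ℕ) → .{{_ : NonZero n}} → Grid n → ℕ → Dir → ℕ → List ℕ → Bool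
matchFrom n Γ p v i []       = true
matchFrom n Γ p v i (a ∷ as) = (Γ (step n p v i) ≡ᵇ a) ∧ matchFrom n Γ p v (suc i) as

appearsAt : (n : ℕ) → .{{_ : NonZero n}} → Grid n → List ℕ → ℕ → Dir → Bool
appearsAt n Γ w p v = matchFrom n Γ p v 0 w

ind : Bool → ℕ
ind true  = 1
ind false = 0

countBelow : (n : ℕ) → .{{_ : NonZero n}} → Grid n → List ℕ → ℕ → ℕ
countBelow n Γ w zero    = 0
countBelow n Γ w (suc k) =
  countBelow n Γ w k + ind (appearsAt n Γ w k plus) + ind (appearsAt n Γ w k minus)

appearances : (n : ℕ) → .{{_ : NonZero n}} → Grid n → List ℕ → ℕ
appearances n Γ w = countBelow n Γ w n

c1 : List ℕ → (n : ℕ) → .{{_ : NonZero n}} → Grid n → ℚ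
c1 w n Γ = (+ appearances n Γ w) / n

open import Data.List using (lookup)
open import Relation.Binary.PropositionalEquality using (_≢_)
open import Data.Product using (∃₂)

TwoDistinctLetters : List ℕ → Set
TwoDistinctLetters w = ∃₂ λ (i j : Fin (length w)) → lookup w i ≢ lookup w j

{-# OPTIONS --safe #-}
-- Unroll a cyclic grid of size n into an n-periodic sequence g. Its number of appearances of w is the sum,
-- over one period, of the appearances of w (in either direction) inside the window of length ℓ = |w| at
-- each position, a quantity that only depends on that window. Letters outside w can be merged into one
-- without losing appearances, leaving K = ℓ + 1 letters. If n > K^ℓ, two windows coincide, at p and
-- p + d say; cutting the cycle at p and p + d gives two shorter cycles whose appearance counts add up to
-- that of g, so the density of g is at most the larger of their densities. Hence the density is maximised
-- among the finitely many grids of size at most K^ℓ + 1.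
module Submission where

open import Defs
open import Data.Nat using (ℕ; suc; NonZero)
open import Data.List using (List)
open import Data.Product using (Σ; ∃-syntax; _,_; proj₁; proj₂)

-- A module of its own, so that ℕ's _≤_ is out of scope in the statement, whose _≤_ is ℚ's.
module _ where
  open import Data.Bool using (Bool; true; false; _∧_; T)
  open import Data.Bool.Properties using (T-∧)
  open import Data.Fin using (Fin; zero; suc; toℕ; fromℕ<; combine)
  open import Data.Fin.Properties using (toℕ-fromℕ<; fromℕ<-cong; combine-injective; pigeonhole; toℕ<n)
  import Data.Integer as ℤ
  open import Data.Integer.Properties using (pos-*)
  open import Data.List using ([]; _∷_; length; lookup)
  open import Data.List.Membership.Propositional using (_∈_)
  open import Data.List.Relation.Unary.All as All using (All)
  open import Data.List.Relation.Unary.Any using (any?; index)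
  open import Data.List.Relation.Unary.Any.Properties using (lookup-index)
  open import Data.Nat
    using (zero; pred; _+_; _*_; _∸_; _^_; _≤_; _<_; _≤?_; _<?_; z≤n; s≤s; z<s; _≡ᵇ_; >-nonZero⁻¹)
  open import Data.Nat.DivMod
    using (_%_; _/_; m%n<n; [m+n]%n≡m%n; [m+kn]%n≡m%n; m≡m%n+[m/n]*n; m<n⇒m%n≡m; %-congˡ)
  open import Data.Nat.Induction using (<-wellFounded)
  open import Data.Nat.Properties
  open import Algebra.Properties.CommutativeSemigroup +-commutativeSemigroup using ()
    renaming (interchange to +-interchange; xy∙z≈xz∙y to +-right-comm)
  open import Algebra.Properties.CommutativeSemigroup *-commutativeSemigroup using ()
    renaming (xy∙z≈xz∙y to *-right-comm)
  open import Data.Nat.Tactic.RingSolver using (solve-∀; solve)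
  open import Data.Product using (_×_)
  import Data.Rational as ℚ
  open import Data.Rational.Properties using (toℚᵘ-cancel-≤; toℚᵘ-fromℚᵘ)
  import Data.Rational.Unnormalised as ℚᵘ
  import Data.Rational.Unnormalised.Properties as ℚᵘ
  open import Data.Sum using (inj₁; inj₂)
  open import Data.Vec.Functional as Vector using (head; tail)
  open import Function using (_∘_)
  open import Function.Bundles using (Equivalence)
  open import Induction.WellFounded using (Acc; acc)
  open import Relation.Binary.PropositionalEquality
  open import Relation.Nullary using (yes; no; contradiction)

  private variable
    A : Set

  sumBelow : ℕ → (ℕ → ℕ) → ℕ
  sumBelow zero    f = 0
  sumBelow (suc n) f = sumBelow n f + f n

  sumBelow-cong : ∀ n {f g} → (∀ s → s < n → f s ≡ g s) → sumBelow n f ≡ sumBelow n g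
  sumBelow-cong zero    f≡g = refl
  sumBelow-cong (suc n) f≡g =
    cong₂ _+_ (sumBelow-cong n (λ s s<n → f≡g s (m<n⇒m<1+n s<n))) (f≡g n ≤-refl)

  sumBelow-mono : ∀ n {f g} → (∀ s → f s ≤ g s) → sumBelow n f ≤ sumBelow n g
  sumBelow-mono zero    f≤g = z≤n
  sumBelow-mono (suc n) f≤g = +-mono-≤ (sumBelow-mono n f≤g) (f≤g n)

  sumBelow-+ : ∀ m n f → sumBelow (m + n) f ≡ sumBelow m f + sumBelow n (λ s → f (m + s))
  sumBelow-+ m zero    f = trans (cong (λ k → sumBelow k f) (+-identityʳ m)) (sym (+-identityʳ _))
  sumBelow-+ m (suc n) f = begin
    sumBelow (m + suc n) f                                      ≡⟨ cong (λ k → sumBelow k f) (+-suc m n) ⟩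
    sumBelow (m + n) f + f (m + n)                              ≡⟨ cong (_+ f (m + n)) (sumBelow-+ m n f) ⟩
    sumBelow m f + sumBelow n (λ s → f (m + s)) + f (m + n)     ≡⟨ +-assoc (sumBelow m f) _ _ ⟩
    sumBelow m f + sumBelow (suc n) (λ s → f (m + s))           ∎
    where open ≡-Reasoning

  sumBelow-distrib : ∀ n f g → sumBelow n (λ s → f s + g s) ≡ sumBelow n f + sumBelow n g
  sumBelow-distrib zero    f g = refl
  sumBelow-distrib (suc n) f g = begin
    sumBelow n (λ s → f s + g s) + (f n + g n)      ≡⟨ cong (_+ (f n + g n)) (sumBelow-distrib n f g) ⟩
    sumBelow n f + sumBelow n g + (f n + g n)       ≡⟨ +-interchange (sumBelow n f) _ _ _ ⟩
    sumBelow n f + f n + (sumBelow n g + g n)       ∎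
    where open ≡-Reasoning

  Periodic : ℕ → (ℕ → A) → Set
  Periodic n g = ∀ k → g (k + n) ≡ g k

  sumBelow-rotate : ∀ n f → Periodic n f → ∀ c → sumBelow n (λ s → f (c + s)) ≡ sumBelow n f
  sumBelow-rotate n f f-periodic zero    = refl
  sumBelow-rotate n f f-periodic (suc c) = begin
    sumBelow n (λ s → f (suc c + s))  ≡⟨ sumBelow-cong n (λ s _ → cong f (sym (+-suc c s))) ⟩
    sumBelow n (λ s → f (c + suc s))  ≡⟨ rotate-by-one (λ s → f (c + s)) f[c+n]≡f[c+0] ⟩
    sumBelow n (λ s → f (c + s))      ≡⟨ sumBelow-rotate n f f-periodic c ⟩
    sumBelow n f                      ∎
    where
    open ≡-Reasoning
    f[c+n]≡f[c+0] : f (c + n) ≡ f (c + 0)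
    f[c+n]≡f[c+0] = trans (f-periodic c) (cong f (sym (+-identityʳ c)))
    rotate-by-one : ∀ h → h n ≡ h 0 → sumBelow n (λ s → h (suc s)) ≡ sumBelow n h
    rotate-by-one h hn≡h0 = +-cancelˡ-≡ (h 0) _ _ (begin
      h 0 + sumBelow n (λ s → h (suc s))  ≡⟨ sumBelow-+ 1 n h ⟨
      sumBelow n h + h n                  ≡⟨ cong (sumBelow n h +_) hn≡h0 ⟩
      sumBelow n h + h 0                  ≡⟨ +-comm (sumBelow n h) (h 0) ⟩
      h 0 + sumBelow n h                  ∎)

  SameWindow : ℕ → (ℕ → A) → ℕ → (ℕ → A) → ℕ → Set
  SameWindow ℓ g s h s′ = ∀ t → t < ℓ → g (s + t) ≡ h (s′ + t)

  WindowLocal : ℕ → ((ℕ → A) → ℕ → ℕ) → Set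
  WindowLocal ℓ E = ∀ g s h s′ → SameWindow ℓ g s h s′ → E g s ≡ E h s′

  periodic-window : ∀ {ℓ n} {g : ℕ → A} → Periodic n g → ∀ s → SameWindow ℓ g (s + n) g s
  periodic-window {n = n} {g} g-periodic s t _ =
    trans (cong g (+-right-comm s n t)) (g-periodic (s + t))

  local-periodic : ∀ {ℓ n E} {g : ℕ → A} → WindowLocal ℓ E → Periodic n g → Periodic n (E g)
  local-periodic E-local g-periodic s = E-local _ _ _ s (periodic-window g-periodic s)

  local-ext : ∀ {ℓ E} {g h : ℕ → A} → WindowLocal ℓ E → (∀ k → g k ≡ h k) → ∀ s → E g s ≡ E h s
  local-ext E-local g≡h s = E-local _ s _ s (λ t _ → g≡h (s + t))

  local-∘ : ∀ {B : Set} {ℓ E} → WindowLocal ℓ E → (f : B → A) → WindowLocal ℓ (λ g → E (f ∘ g))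
  local-∘ E-local f g s h s′ same = E-local (f ∘ g) s (f ∘ h) s′ (λ t t<ℓ → cong f (same t t<ℓ))

  -- unroll n Γ (p + i) is definitionally Γ (step n p plus i).
  unroll : ∀ n .{{_ : NonZero n}} → (Fin n → A) → ℕ → A
  unroll n Γ k = Γ (fromℕ< (m%n<n k n))

  unroll-cong-% : ∀ n .{{_ : NonZero n}} (Γ : Fin n → A) x y → x % n ≡ y % n → unroll n Γ x ≡ unroll n Γ y
  unroll-cong-% n Γ x y x%n≡y%n = cong Γ (fromℕ<-cong _ _ x%n≡y%n _ _)

  unroll-periodic : ∀ n .{{_ : NonZero n}} (Γ : Fin n → A) → Periodic n (unroll n Γ)
  unroll-periodic n Γ k = unroll-cong-% n Γ _ _ ([m+n]%n≡m%n k n)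

  segment : ℕ → (d : ℕ) → (ℕ → A) → Fin d → A
  segment p d g x = g (p + toℕ x)

  unroll-segment : ∀ p d .{{_ : NonZero d}} (g : ℕ → A) k → unroll d (segment p d g) k ≡ g (p + k % d)
  unroll-segment p d g k = cong (λ r → g (p + r)) (toℕ-fromℕ< (m%n<n k d))

  repeat⇒periodic-stretch : ∀ {ℓ} p d .{{_ : NonZero d}} (g : ℕ → A) → SameWindow ℓ g (p + d) g p →
                            ∀ k → k < d + ℓ → g (p + k) ≡ g (p + k % d)
  repeat⇒periodic-stretch {ℓ = ℓ} p d g repeat k = go k (<-wellFounded k)
    where
    open ≡-Reasoning
    go : ∀ k → Acc _<_ k → k < d + ℓ → g (p + k) ≡ g (p + k % d)
    go k (acc smaller) k<d+ℓ with k <? d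
    ... | yes k<d = cong (λ r → g (p + r)) (sym (m<n⇒m%n≡m k<d))
    ... | no k≮d with t , refl ← m≤n⇒∃[o]m+o≡n (≮⇒≥ k≮d) = begin
      g (p + (d + t))      ≡⟨ cong g (+-assoc p d t) ⟨
      g (p + d + t)        ≡⟨ repeat t (+-cancelˡ-< d t ℓ k<d+ℓ) ⟩
      g (p + t)            ≡⟨ go t (smaller t<d+t) (<-≤-trans t<d+t (<⇒≤ k<d+ℓ)) ⟩
      g (p + t % d)        ≡⟨ cong (λ r → g (p + r)) (trans (cong (_% d) (+-comm d t)) ([m+n]%n≡m%n t d)) ⟨
      g (p + (d + t) % d)  ∎
      where
      t<d+t : t < d + t
      t<d+t = m<n+m t (>-nonZero⁻¹ d)

  cyclicSum : ((ℕ → A) → ℕ → ℕ) → ∀ n .{{_ : NonZero n}} → (Fin n → A) → ℕ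
  cyclicSum E n φ = sumBelow n (E (unroll n φ))

  module _ {A : Set} {ℓ} {E : (ℕ → A) → ℕ → ℕ} (E-local : WindowLocal ℓ E) where

    sumBelow-segment : ∀ p d .{{_ : NonZero d}} g → SameWindow ℓ g (p + d) g p →
                       sumBelow d (λ s → E g (p + s)) ≡ cyclicSum E d (segment p d g)
    sumBelow-segment p d g repeat = sumBelow-cong d λ s s<d → E-local _ _ _ _ λ t t<ℓ → begin
      g (p + s + t)                      ≡⟨ cong g (+-assoc p s t) ⟩
      g (p + (s + t))                    ≡⟨ repeat⇒periodic-stretch p d g repeat (s + t) (+-mono-< s<d t<ℓ) ⟩
      g (p + (s + t) % d)                ≡⟨ unroll-segment p d g (s + t) ⟨
      unroll d (segment p d g) (s + t)   ∎
      where open ≡-Reasoning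

    cyclicSum-cong : ∀ n .{{_ : NonZero n}} {φ φ′ : Fin n → A} → (∀ x → φ x ≡ φ′ x) →
                     cyclicSum E n φ ≡ cyclicSum E n φ′
    cyclicSum-cong n φ≗φ′ = sumBelow-cong n (λ s _ → local-ext E-local (λ k → φ≗φ′ _) s)

    cyclicSum-cut : ∀ d e .{{_ : NonZero d}} .{{_ : NonZero e}} {g} p → Periodic (d + e) g →
                    SameWindow ℓ g (p + d) g p →
                    sumBelow (d + e) (E g) ≡ cyclicSum E d (segment p d g) + cyclicSum E e (segment (p + d) e g)
    cyclicSum-cut d e {g} p g-periodic repeat = begin
      sumBelow (d + e) (E g)
        ≡⟨ sumBelow-rotate (d + e) (E g) (local-periodic E-local g-periodic) p ⟨
      sumBelow (d + e) (λ s → E g (p + s))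
        ≡⟨ sumBelow-+ d e _ ⟩
      sumBelow d (λ s → E g (p + s)) + sumBelow e (λ s → E g (p + (d + s)))
        ≡⟨ cong (sumBelow d (λ s → E g (p + s)) +_) (sumBelow-cong e (λ s _ → cong (E g) (+-assoc p d s))) ⟨
      sumBelow d (λ s → E g (p + s)) + sumBelow e (λ s → E g (p + d + s))
        ≡⟨ cong₂ _+_ (sumBelow-segment p d g repeat) (sumBelow-segment (p + d) e g repeat-next) ⟩
      cyclicSum E d (segment p d g) + cyclicSum E e (segment (p + d) e g)
        ∎
      where
      open ≡-Reasoning
      repeat-next : SameWindow ℓ g (p + d + e) g (p + d)
      repeat-next t t<ℓ = begin
        g (p + d + e + t)    ≡⟨ cong (λ x → g (x + t)) (+-assoc p d e) ⟩
        g (p + (d + e) + t)  ≡⟨ periodic-window {ℓ = ℓ} g-periodic p t t<ℓ ⟩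
        g (p + t)            ≡⟨ repeat t t<ℓ ⟨
        g (p + d + t)        ∎

  spells : (ℕ → ℕ) → List ℕ → Bool
  spells h []      = true
  spells h (a ∷ u) = (h 0 ≡ᵇ a) ∧ spells (h ∘ suc) u

  spells-cong : ∀ u {h h′} → (∀ j → j < length u → h j ≡ h′ j) → spells h u ≡ spells h′ u
  spells-cong []      h≡h′ = refl
  spells-cong (a ∷ u) h≡h′ =
    cong₂ _∧_ (cong (_≡ᵇ a) (h≡h′ 0 z<s)) (spells-cong u (λ j j<ℓ → h≡h′ (suc j) (s≤s j<ℓ)))

  matchFrom-spells : ∀ n .{{_ : NonZero n}} Γ p v i u →
                     matchFrom n Γ p v i u ≡ spells (λ j → Γ (step n p v (i + j))) u
  matchFrom-spells n Γ p v i []      = refl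
  matchFrom-spells n Γ p v i (a ∷ u) = cong₂ _∧_
    (cong (λ k → Γ (step n p v k) ≡ᵇ a) (sym (+-identityʳ i)))
    (trans (matchFrom-spells n Γ p v (suc i) u)
           (spells-cong u (λ j _ → cong (λ k → Γ (step n p v k)) (sym (+-suc i j)))))

  forwardAt : List ℕ → (ℕ → ℕ) → ℕ → ℕ
  forwardAt w g s = ind (spells (λ j → g (s + j)) w)

  -- An appearance of w in direction -1 whose last letter sits at s.
  backwardAt : List ℕ → (ℕ → ℕ) → ℕ → ℕ
  backwardAt w g s = ind (spells (λ j → g (s + (pred (length w) ∸ j))) w)

  occurrencesAt : List ℕ → (ℕ → ℕ) → ℕ → ℕ
  occurrencesAt w g s = forwardAt w g s + backwardAt w g s

  backwardAt-local : ∀ w → WindowLocal (length w) (backwardAt w)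
  backwardAt-local w g s h s′ same = cong ind (spells-cong w (λ j j<ℓ → same _ (reflect-< j<ℓ)))
    where
    reflect-< : ∀ {ℓ j} → j < ℓ → pred ℓ ∸ j < ℓ
    reflect-< {suc L} {j} _ = s≤s (m∸n≤m L j)

  occurrencesAt-local : ∀ w → WindowLocal (length w) (occurrencesAt w)
  occurrencesAt-local w g s h s′ same =
    cong₂ _+_ (cong ind (spells-cong w same)) (backwardAt-local w g s h s′ same)

  %-reflect : ∀ n′ L j p → j ≤ L →
              (p + (suc n′ ∸ j % suc n′)) % suc n′ ≡ (L * n′ + p + (L ∸ j)) % suc n′
  %-reflect n′ L j p j≤L = begin
    (p + (N ∸ r)) % N                         ≡⟨ [m+kn]%n≡m%n (p + (N ∸ r)) L N ⟨
    (p + (N ∸ r) + L * N) % N                 ≡⟨ %-congˡ (reflect-identity n′ p (L ∸ j) (N ∸ r) r q L L≡ N∸r+r≡N) ⟩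
    (L * n′ + p + (L ∸ j) + suc q * N) % N    ≡⟨ [m+kn]%n≡m%n (L * n′ + p + (L ∸ j)) (suc q) N ⟩
    (L * n′ + p + (L ∸ j)) % N                ∎
    where
    open ≡-Reasoning
    N r q : ℕ
    N = suc n′
    r = j % N
    q = j / N
    L≡ : L ∸ j + (r + q * N) ≡ L
    L≡ = trans (cong (L ∸ j +_) (sym (m≡m%n+[m/n]*n j N))) (m∸n+n≡m j≤L)
    N∸r+r≡N : N ∸ r + r ≡ N
    N∸r+r≡N = m∸n+n≡m (<⇒≤ (m%n<n j N))
    reflect-identity : ∀ n′ p a b r q L → a + (r + q * suc n′) ≡ L → b + r ≡ suc n′ →
                       p + b + L * suc n′ ≡ L * n′ + p + a + suc q * suc n′
    reflect-identity n′ p a b r q _ refl b+r≡N = +-cancelʳ-≡ r _ _ (begin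
      p + b + (a + (r + q * suc n′)) * suc n′ + r
        ≡⟨ solve (n′ ∷ p ∷ a ∷ b ∷ r ∷ q ∷ []) ⟩
      p + (b + r) + (a + (r + q * suc n′)) * suc n′
        ≡⟨ cong (λ x → p + x + (a + (r + q * suc n′)) * suc n′) b+r≡N ⟩
      p + suc n′ + (a + (r + q * suc n′)) * suc n′
        ≡⟨ solve (n′ ∷ p ∷ a ∷ r ∷ q ∷ []) ⟩
      (a + (r + q * suc n′)) * n′ + p + a + suc q * suc n′ + r
        ∎)

  countBelow-sumBelow : ∀ n .{{_ : NonZero n}} Γ w k →
    countBelow n Γ w k ≡ sumBelow k (λ p → ind (appearsAt n Γ w p plus) + ind (appearsAt n Γ w p minus))
  countBelow-sumBelow n Γ w zero    = refl
  countBelow-sumBelow n Γ w (suc k) rewrite countBelow-sumBelow n Γ w k =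
    +-assoc _ (ind (appearsAt n Γ w k plus)) (ind (appearsAt n Γ w k minus))

  -- pred ℓ * n′ ≡ -(ℓ - 1) modulo suc n′: the appearance read in direction -1 from p ends at p - (ℓ - 1).
  appearsAt-minus : ∀ n′ (Γ : Grid (suc n′)) w p → appearsAt (suc n′) Γ w p minus ≡
    spells (λ j → unroll (suc n′) Γ (pred (length w) * n′ + p + (pred (length w) ∸ j))) w
  appearsAt-minus n′ Γ w p = trans (matchFrom-spells (suc n′) Γ p minus 0 w) (spells-cong w same-letter)
    where
    L : ℕ
    L = pred (length w)
    same-letter : ∀ j → j < length w →
                  unroll (suc n′) Γ (p + (suc n′ ∸ j % suc n′)) ≡ unroll (suc n′) Γ (L * n′ + p + (L ∸ j))
    same-letter j j<ℓ = unroll-cong-% (suc n′) Γ (p + (suc n′ ∸ j % suc n′)) (L * n′ + p + (L ∸ j))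
                                      (%-reflect n′ L j p (<⇒≤pred j<ℓ))

  appearances-as-sum : ∀ n .{{_ : NonZero n}} (Γ : Grid n) w →
                       appearances n Γ w ≡ sumBelow n (occurrencesAt w (unroll n Γ))
  appearances-as-sum n@(suc n′) Γ w = begin
    countBelow n Γ w n
      ≡⟨ countBelow-sumBelow n Γ w n ⟩
    sumBelow n (λ p → ind (appearsAt n Γ w p plus) + ind (appearsAt n Γ w p minus))
      ≡⟨ sumBelow-distrib n _ _ ⟩
    sumBelow n (λ p → ind (appearsAt n Γ w p plus)) + sumBelow n (λ p → ind (appearsAt n Γ w p minus))
      ≡⟨ cong₂ _+_ (sumBelow-cong n (λ p _ → cong ind (matchFrom-spells n Γ p plus 0 w)))
                   (sumBelow-cong n (λ p _ → cong ind (appearsAt-minus n′ Γ w p))) ⟩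
    sumBelow n (forwardAt w g) + sumBelow n (λ p → backwardAt w g (c + p))
      ≡⟨ cong (sumBelow n (forwardAt w g) +_)
              (sumBelow-rotate n (backwardAt w g) (local-periodic (backwardAt-local w) (unroll-periodic n Γ)) c) ⟩
    sumBelow n (forwardAt w g) + sumBelow n (backwardAt w g)
      ≡⟨ sumBelow-distrib n _ _ ⟨
    sumBelow n (occurrencesAt w g)
      ∎
    where
    open ≡-Reasoning
    g : ℕ → ℕ
    g = unroll n Γ
    c : ℕ
    c = pred (length w) * n′

  ind-mono : ∀ {x y} → (T x → T y) → ind x ≤ ind y
  ind-mono {false}         _     = z≤n
  ind-mono {true}  {true}  _     = ≤-refl
  ind-mono {true}  {false} x⇒y = contradiction (x⇒y _) λ ()

  spells-recolour : ∀ (ρ : ℕ → ℕ) h u → All (λ a → ρ a ≡ a) u → T (spells h u) → T (spells (ρ ∘ h) u)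
  spells-recolour ρ h []      All.[]                  _        = _
  spells-recolour ρ h (a ∷ u) (ρa≡a All.∷ ρ-fixes-u) h-spells
    with h0≡a , h-spells-u ← Equivalence.to T-∧ h-spells =
    Equivalence.from T-∧ ( ≡⇒≡ᵇ _ _ (trans (cong ρ (≡ᵇ⇒≡ _ _ h0≡a)) ρa≡a)
                         , spells-recolour ρ (h ∘ suc) u ρ-fixes-u h-spells-u)

  appearances-recolour : ∀ n .{{_ : NonZero n}} (Γ : Grid n) w (ρ : ℕ → ℕ) → All (λ a → ρ a ≡ a) w →
                         appearances n Γ w ≤ appearances n (ρ ∘ Γ) w
  appearances-recolour n Γ w ρ ρ-fixes-w = begin
    appearances n Γ w                           ≡⟨ appearances-as-sum n Γ w ⟩
    sumBelow n (occurrencesAt w g)              ≤⟨ sumBelow-mono n (λ s → +-mono-≤ (recolour _) (recolour _)) ⟩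
    sumBelow n (occurrencesAt w (ρ ∘ g))        ≡⟨ appearances-as-sum n (ρ ∘ Γ) w ⟨
    appearances n (ρ ∘ Γ) w                     ∎
    where
    open ≤-Reasoning
    g : ℕ → ℕ
    g = unroll n Γ
    recolour : ∀ h → ind (spells h w) ≤ ind (spells (ρ ∘ h) w)
    recolour h = ind-mono (spells-recolour ρ h w ρ-fixes-w)

  -- Letters outside w all get the code zero; the letter it decodes to is irrelevant, since recolouring never
  -- destroys an appearance.
  encode : (w : List ℕ) → ℕ → Fin (suc (length w))
  encode w a with any? (a ≟_) w
  ... | yes a∈w = suc (index a∈w)
  ... | no  _   = zero

  decode : (w : List ℕ) → Fin (suc (length w)) → ℕ
  decode w zero    = 0
  decode w (suc i) = lookup w i

  decode-encode : ∀ w {a} → a ∈ w → decode w (encode w a) ≡ a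
  decode-encode w {a} a∈w with any? (a ≟_) w
  ... | yes a∈w′ = sym (lookup-index a∈w′)
  ... | no  a∉w  = contradiction a∈w a∉w

  windowCode : ∀ {K} → (ℕ → Fin K) → ℕ → (L : ℕ) → Fin (K ^ L)
  windowCode g s zero    = zero
  windowCode g s (suc L) = combine (g s) (windowCode g (suc s) L)

  windowCode-injective : ∀ {K} {g : ℕ → Fin K} s s′ L →
                         windowCode g s L ≡ windowCode g s′ L → SameWindow L g s g s′
  windowCode-injective {g = g} s s′ (suc L) same-code zero _ = begin
    g (s + 0)   ≡⟨ cong g (+-identityʳ s) ⟩
    g s         ≡⟨ proj₁ (combine-injective (g s) _ (g s′) _ same-code) ⟩
    g s′        ≡⟨ cong g (+-identityʳ s′) ⟨
    g (s′ + 0)  ∎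
    where open ≡-Reasoning
  windowCode-injective {g = g} s s′ (suc L) same-code (suc t) (s≤s t<L) = begin
    g (s + suc t)    ≡⟨ cong g (+-suc s t) ⟩
    g (suc s + t)    ≡⟨ windowCode-injective (suc s) (suc s′) L tail-code t t<L ⟩
    g (suc s′ + t)   ≡⟨ cong g (+-suc s′ t) ⟨
    g (s′ + suc t)   ∎
    where
    open ≡-Reasoning
    tail-code : windowCode g (suc s) L ≡ windowCode g (suc s′) L
    tail-code = proj₂ (combine-injective (g s) _ (g s′) _ same-code)

  repeated-window : ∀ {K} ℓ n (g : ℕ → Fin K) → K ^ ℓ < n →
                    ∃[ p ] ∃[ d ] ∃[ e ] (suc d + suc e ≡ n × SameWindow ℓ g (p + suc d) g p)
  repeated-window ℓ n g Kℓ<n with pigeonhole Kℓ<n (λ x → windowCode g (toℕ x) ℓ)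
  ... | i , j , i<j , same-code
    with d , i+1+d≡j ← m≤n⇒∃[o]m+o≡n i<j
       | e , j+1+e≡n ← m≤n⇒∃[o]m+o≡n (toℕ<n j)
    = p , d , p + e , sizes , windowCode-injective (p + suc d) p ℓ repeated-code
    where
    open ≡-Reasoning
    p : ℕ
    p = toℕ i
    sizes : suc d + suc (p + e) ≡ n
    sizes = begin
      suc d + suc (p + e)  ≡⟨ reorder p d e ⟩
      suc (suc p + d) + e  ≡⟨ cong (λ x → suc x + e) i+1+d≡j ⟩
      suc (toℕ j) + e      ≡⟨ j+1+e≡n ⟩
      n                    ∎
      where
      reorder : ∀ p d e → suc d + suc (p + e) ≡ suc (suc p + d) + e
      reorder = solve-∀
    repeated-code : windowCode g (p + suc d) ℓ ≡ windowCode g p ℓ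
    repeated-code = trans (cong (λ s → windowCode g s ℓ) (trans (+-suc p d) i+1+d≡j)) (sym same-code)

  density-bound : ∀ {K ℓ} {E : (ℕ → Fin K) → ℕ → ℕ} → WindowLocal ℓ E → ∀ S B →
                  (∀ k → k ≤ K ^ ℓ → (ψ : Fin (suc k) → Fin K) → cyclicSum E (suc k) ψ * S ≤ B * suc k) →
                  ∀ n .{{_ : NonZero n}} (φ : Fin n → Fin K) → cyclicSum E n φ * S ≤ B * n
  density-bound {K} {ℓ} {E} E-local S B small n = go n (<-wellFounded n)
    where
    go : ∀ n .{{_ : NonZero n}} → Acc _<_ n → (φ : Fin n → Fin K) → cyclicSum E n φ * S ≤ B * n
    go (suc n′) (acc smaller) φ with n′ ≤? K ^ ℓ
    ... | yes n′≤Kℓ = small n′ n′≤Kℓ φ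
    ... | no  n′≰Kℓ
      with p , d , e , refl , repeat ← repeated-window ℓ (suc n′) (unroll (suc n′) φ) (m<n⇒m<1+n (≰⇒> n′≰Kℓ))
      = begin
      cyclicSum E (suc d + suc e) φ * S
        ≡⟨ cong (_* S) (cyclicSum-cut E-local (suc d) (suc e) p (unroll-periodic _ φ) repeat) ⟩
      (c₁ + c₂) * S
        ≡⟨ *-distribʳ-+ S c₁ c₂ ⟩
      c₁ * S + c₂ * S
        ≤⟨ +-mono-≤ (go (suc d) (smaller (m<m+n (suc d) z<s)) φ₁)
                    (go (suc e) (smaller (m<n+m (suc e) z<s)) φ₂) ⟩
      B * suc d + B * suc e
        ≡⟨ *-distribˡ-+ B (suc d) (suc e) ⟨
      B * (suc d + suc e)
        ∎
      where
      open ≤-Reasoning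
      g : ℕ → Fin K
      g = unroll (suc d + suc e) φ
      φ₁ : Fin (suc d) → Fin K
      φ₁ = segment p (suc d) g
      φ₂ : Fin (suc e) → Fin K
      φ₂ = segment (p + suc d) (suc e) g
      c₁ c₂ : ℕ
      c₁ = cyclicSum E (suc d) φ₁
      c₂ = cyclicSum E (suc e) φ₂

  argmax-Fin : ∀ m (f : Fin (suc m) → ℕ) → ∃[ x* ] (∀ x → f x ≤ f x*)
  argmax-Fin zero    f = zero , λ { zero → ≤-refl }
  argmax-Fin (suc m) f with argmax-Fin m (f ∘ suc)
  ... | y* , y*-best with f zero ≤? f (suc y*)
  ... | yes f0≤ = suc y* , λ { zero → f0≤ ; (suc y) → y*-best y }
  ... | no  f0≰ = zero , λ { zero → ≤-refl ; (suc y) → ≤-trans (y*-best y) (<⇒≤ (≰⇒> f0≰)) }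

  argmax-function : ∀ k m (σ : (Fin k → Fin (suc m)) → ℕ) →
                    (∀ {ψ ψ′} → (∀ x → ψ x ≡ ψ′ x) → σ ψ ≡ σ ψ′) → ∃[ ψ* ] (∀ ψ → σ ψ ≤ σ ψ*)
  argmax-function zero    m σ σ-ext = (λ ()) , λ ψ → ≤-reflexive (σ-ext (λ ()))
  argmax-function (suc k) m σ σ-ext = best x* , best-is-max
    where
    best-tail : ∀ x → ∃[ τ* ] (∀ τ → σ (x Vector.∷ τ) ≤ σ (x Vector.∷ τ*))
    best-tail x = argmax-function k m (λ τ → σ (x Vector.∷ τ))
                                  (λ τ≗τ′ → σ-ext λ { zero → refl ; (suc i) → τ≗τ′ i })
    best : Fin (suc m) → Fin (suc k) → Fin (suc m)
    best x = x Vector.∷ proj₁ (best-tail x)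
    x* : Fin (suc m)
    x* = proj₁ (argmax-Fin m (σ ∘ best))
    best-is-max : ∀ ψ → σ ψ ≤ σ (best x*)
    best-is-max ψ = begin
      σ ψ                          ≡⟨ σ-ext (λ { zero → refl ; (suc i) → refl }) ⟩
      σ (head ψ Vector.∷ tail ψ)   ≤⟨ proj₂ (best-tail (head ψ)) (tail ψ) ⟩
      σ (best (head ψ))            ≤⟨ proj₂ (argmax-Fin m (σ ∘ best)) (head ψ) ⟩
      σ (best x*)                  ∎
      where open ≤-Reasoning

  cross-≤-trans : ∀ a b c x y z .{{_ : NonZero y}} → a * y ≤ b * x → b * z ≤ c * y → a * z ≤ c * x
  cross-≤-trans a b c x y z a/x≤b/y b/y≤c/z = *-cancelʳ-≤ (a * z) (c * x) y (begin
    a * z * y   ≡⟨ *-right-comm a z y ⟩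
    a * y * z   ≤⟨ *-monoˡ-≤ z a/x≤b/y ⟩
    b * x * z   ≡⟨ *-right-comm b x z ⟩
    b * z * x   ≤⟨ *-monoˡ-≤ x b/y≤c/z ⟩
    c * y * x   ≡⟨ *-right-comm c y x ⟩
    c * x * y   ∎)
    where open ≤-Reasoning

  argmax-ratio : ∀ N (a : ℕ → ℕ) → ∃[ k* ] (∀ k → k ≤ N → a k * suc k* ≤ a k* * suc k)
  argmax-ratio zero    a = 0 , λ { zero z≤n → ≤-refl }
  argmax-ratio (suc N) a with argmax-ratio N a
  ... | k* , k*-best with a (suc N) * suc k* ≤? a k* * suc (suc N)
  ... | yes last≤k* = k* , extend
    where
    extend : ∀ k → k ≤ suc N → a k * suc k* ≤ a k* * suc k
    extend k k≤1+N with m≤n⇒m<n∨m≡n k≤1+N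
    ... | inj₁ k<1+N = k*-best k (m<1+n⇒m≤n k<1+N)
    ... | inj₂ refl  = last≤k*
  ... | no  last≰k* = suc N , extend
    where
    extend : ∀ k → k ≤ suc N → a k * suc (suc N) ≤ a (suc N) * suc k
    extend k k≤1+N with m≤n⇒m<n∨m≡n k≤1+N
    ... | inj₁ k<1+N = cross-≤-trans (a k) (a k*) (a (suc N)) (suc k) (suc k*) (suc (suc N))
                                     (k*-best k (m<1+n⇒m≤n k<1+N)) (<⇒≤ (≰⇒> last≰k*))
    ... | inj₂ refl  = ≤-refl

  argmax-density : ∀ N m (σ : ∀ k → (Fin (suc k) → Fin (suc m)) → ℕ) →
                   (∀ k {ψ ψ′} → (∀ x → ψ x ≡ ψ′ x) → σ k ψ ≡ σ k ψ′) →
                   ∃[ k* ] Σ (Fin (suc k*) → Fin (suc m)) λ ψ* →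
                     ∀ k → k ≤ N → (ψ : Fin (suc k) → Fin (suc m)) → σ k ψ * suc k* ≤ σ k* ψ* * suc k
  argmax-density N m σ σ-ext = k* , proj₁ (best k*) , λ k k≤N ψ →
    ≤-trans (*-monoˡ-≤ (suc k*) (proj₂ (best k) ψ)) (proj₂ best-ratio k k≤N)
    where
    best : ∀ k → ∃[ ψ* ] (∀ ψ → σ k ψ ≤ σ k ψ*)
    best k = argmax-function (suc k) m (σ k) (σ-ext k)
    best-ratio : ∃[ k* ] (∀ k → k ≤ N → σ k (proj₁ (best k)) * suc k* ≤ σ k* (proj₁ (best k*)) * suc k)
    best-ratio = argmax-ratio N (λ k → σ k (proj₁ (best k)))
    k* : ℕ
    k* = proj₁ best-ratio

  module _ (w : List ℕ) where
    private
      ℓ K : ℕ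
      ℓ = length w
      K = suc ℓ
      E : (ℕ → Fin K) → ℕ → ℕ
      E g = occurrencesAt w (decode w ∘ g)
      E-local : WindowLocal ℓ E
      E-local = local-∘ (occurrencesAt-local w) (decode w)
      coded : ∀ n .{{_ : NonZero n}} (φ : Fin n → Fin K) → appearances n (decode w ∘ φ) w ≡ cyclicSum E n φ
      coded n φ = appearances-as-sum n (decode w ∘ φ) w
      maximiser : ∃[ k* ] Σ (Fin (suc k*) → Fin K) λ ψ* →
                    ∀ k → k ≤ K ^ ℓ → ∀ ψ → cyclicSum E (suc k) ψ * suc k* ≤ cyclicSum E (suc k*) ψ* * suc k
      maximiser = argmax-density (K ^ ℓ) ℓ (λ k → cyclicSum E (suc k)) (λ k → cyclicSum-cong E-local (suc k))
      k* : ℕ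
      k* = proj₁ maximiser
      ψ* : Fin (suc k*) → Fin K
      ψ* = proj₁ (proj₂ maximiser)

    optimal-grid : ∃[ k ] Σ (Grid (suc k)) λ Γ →
                   ∀ m .{{_ : NonZero m}} (Γ′ : Grid m) → appearances m Γ′ w * suc k ≤ appearances (suc k) Γ w * m
    optimal-grid = k* , decode w ∘ ψ* , optimal
      where
      optimal : ∀ m .{{_ : NonZero m}} (Γ′ : Grid m) →
                appearances m Γ′ w * suc k* ≤ appearances (suc k*) (decode w ∘ ψ*) w * m
      optimal m Γ′ = begin
        appearances m Γ′ w * suc k*
          ≤⟨ *-monoˡ-≤ (suc k*) (appearances-recolour m Γ′ w (decode w ∘ encode w)
                                                      (All.tabulate (decode-encode w))) ⟩
        appearances m (decode w ∘ encode w ∘ Γ′) w * suc k*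
          ≡⟨ cong (_* suc k*) (coded m (encode w ∘ Γ′)) ⟩
        cyclicSum E m (encode w ∘ Γ′) * suc k*
          ≤⟨ density-bound E-local (suc k*) (cyclicSum E (suc k*) ψ*) (proj₂ (proj₂ maximiser))
                           m (encode w ∘ Γ′) ⟩
        cyclicSum E (suc k*) ψ* * m
          ≡⟨ cong (_* m) (coded (suc k*) ψ*) ⟨
        appearances (suc k*) (decode w ∘ ψ*) w * m
          ∎
        where open ≤-Reasoning

  cross-≤⇒/-≤ : ∀ a b m n .{{_ : NonZero m}} .{{_ : NonZero n}} →
                a * n ≤ b * m → ℤ.+ a ℚ./ m ℚ.≤ ℤ.+ b ℚ./ n
  cross-≤⇒/-≤ a b (suc m) (suc n) an≤bm = toℚᵘ-cancel-≤
    (ℚᵘ.≤-respˡ-≃ (ℚᵘ.≃-sym (toℚᵘ-fromℚᵘ (ℚᵘ.mkℚᵘ (ℤ.+ a) m)))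
    (ℚᵘ.≤-respʳ-≃ (ℚᵘ.≃-sym (toℚᵘ-fromℚᵘ (ℚᵘ.mkℚᵘ (ℤ.+ b) n)))
    (ℚᵘ.*≤* (subst₂ ℤ._≤_ (pos-* a (suc n)) (pos-* b (suc m)) (ℤ.+≤+ an≤bm)))))

open import Data.Rational using (_≤_)

corollary3p9 : (w : List ℕ) → TwoDistinctLetters w →
    ∃[ n ] Σ (NonZero n) λ nz → Σ (Grid n) λ Γ →
      ((m : ℕ) → .{{_ : NonZero m}} → (Γ' : Grid m) →
        c1 w m Γ' ≤ c1 w n {{nz}} Γ)
corollary3p9 w _ = suc k , _ , Γ , λ m Γ′ →
    cross-≤⇒/-≤ (appearances m Γ′ w) (appearances (suc k) Γ w) m (suc k)
                (proj₂ (proj₂ (optimal-grid w)) m Γ′)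
  where
  k : ℕ
  k = proj₁ (optimal-grid w)
  Γ : Grid (suc k)
  Γ = proj₁ (proj₂ (optimal-grid w))
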